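{- Every graph that has exactly one component containing an edge, this component being a candy (all other components being isolated vertices), is line $[B,-]$-nice.
   Context: For $m\ge1$ and $n_1,n_2\in\mathbb N$, an $(m,n_1,n_2)$-candy consists of the complete bipartite graph $K_{2,m}$ with parts $\{v_1,v_2\}$ and $\{w_1,\dots,w_m\}$, plus $n_1$ leaves attached to $v_1$ and $n_2$ leaves attached to $v_2$; a candy is an $(m,n_1,n_2)$-candy for some such parameters. In the $[B,-]$-edge colouring game with $k$ colours, Bob and Alice alternately colour a previously uncoloured edge with one of $k$ colours so that edges sharing an endpoint get distinct colours; Bob moves first; no player may skip. The game ends when no move is possible; Alice wins iff all edges are coloured. A graph $G$ is line $[B,-]$-nice if the least $k$ for which Alice has a winning strategy equals $\omega(L(G))$, the maximum number of pairwise adjacent edges of $G$. -}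

module Defs where

open import Data.Nat using (ℕ; _≤_; _<_)
open import Data.Fin using (Fin)
open import Data.List using (List; []; _∷_; length)
open import Data.List.Membership.Propositional using (_∈_; _∉_)
open import Data.List.Relation.Unary.AllPairs using (AllPairs)
open import Data.Product using (Σ; ∃; ∃-syntax; _×_; _,_)
open import Data.Sum using (_⊎_)
open import Relation.Nullary using (¬_)
open import Relation.Binary.PropositionalEquality using (_≡_; _≢_)

record Graph : Set₁ where
  field
    V    : Set
    E    : Set
    end₁ : E → V
    end₂ : E → V

open Graph public

-- Two distinct edges are adjacent iff they share an endpoint
-- (adjacency in the line graph L(G)).
Adjacent : (G : Graph) → E G → E G → Set
Adjacent G e f =
  e ≢ f ×
  (  end₁ G e ≡ end₁ G f
   ⊎ end₁ G e ≡ end₂ G f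
   ⊎ end₂ G e ≡ end₁ G f
   ⊎ end₂ G e ≡ end₂ G f)

IsLineClique : (G : Graph) → List (E G) → Set
IsLineClique G es = AllPairs (Adjacent G) es

IsLineCliqueNumber : (G : Graph) → ℕ → Set
IsLineCliqueNumber G w =
  (∃[ es ] (IsLineClique G es × length es ≡ w)) ×
  (∀ es → IsLineClique G es → length es ≤ w)

Position : Graph → ℕ → Set
Position G k = List (E G × Fin k)

Coloured : (G : Graph) {k : ℕ} → Position G k → E G → Set
Coloured G p e = ∃[ c ] ((e , c) ∈ p)

Legal : (G : Graph) {k : ℕ} → Position G k → E G → Fin k → Set
Legal G p e c = ¬ Coloured G p e × (∀ f → Adjacent G e f → (f , c) ∉ p)

HasMove : (G : Graph) {k : ℕ} → Position G k → Set
HasMove G p = ∃[ e ] ∃[ c ] Legal G p e c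

Complete : (G : Graph) {k : ℕ} → Position G k → Set
Complete G p = ∀ e → Coloured G p e

-- Alice can force a win from position p
--   * WinBobTurn : Bob is to move,  * WinAliceTurn : Alice is to move.
-- The game ends when no move is possible; Alice wins iff all edges
-- are coloured. No skipping.
mutual
  data WinBobTurn (G : Graph) (k : ℕ) (p : Position G k) : Set where
    finished : Complete G p → WinBobTurn G k p
    bobMoves : HasMove G p →
               (∀ e c → Legal G p e c → WinAliceTurn G k ((e , c) ∷ p)) →
               WinBobTurn G k p

  data WinAliceTurn (G : Graph) (k : ℕ) (p : Position G k) : Set where
    finished   : Complete G p → WinAliceTurn G k p
    aliceMoves : ∀ e c → Legal G p e c → WinBobTurn G k ((e , c) ∷ p) →
                 WinAliceTurn G k p

AliceWins : Graph → ℕ → Set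
AliceWins G k = WinBobTurn G k []

LineBNice : Graph → Set
LineBNice G = ∀ w → IsLineCliqueNumber G w →
  AliceWins G w × (∀ k → k < w → ¬ AliceWins G k)

data CandyV (m n₁ n₂ r : ℕ) : Set where
  v₁ v₂ : CandyV m n₁ n₂ r
  w     : Fin m  → CandyV m n₁ n₂ r
  leaf₁ : Fin n₁ → CandyV m n₁ n₂ r
  leaf₂ : Fin n₂ → CandyV m n₁ n₂ r
  iso   : Fin r  → CandyV m n₁ n₂ r

data CandyE (m n₁ n₂ : ℕ) : Set where
  v₁w   : Fin m  → CandyE m n₁ n₂
  v₂w   : Fin m  → CandyE m n₁ n₂
  pend₁ : Fin n₁ → CandyE m n₁ n₂
  pend₂ : Fin n₂ → CandyE m n₁ n₂

candyEnd₁ : ∀ {m n₁ n₂ r} → CandyE m n₁ n₂ → CandyV m n₁ n₂ r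
candyEnd₁ (v₁w i)   = v₁
candyEnd₁ (v₂w i)   = v₂
candyEnd₁ (pend₁ j) = v₁
candyEnd₁ (pend₂ j) = v₂

candyEnd₂ : ∀ {m n₁ n₂ r} → CandyE m n₁ n₂ → CandyV m n₁ n₂ r
candyEnd₂ (v₁w i)   = w i
candyEnd₂ (v₂w i)   = w i
candyEnd₂ (pend₁ j) = leaf₁ j
candyEnd₂ (pend₂ j) = leaf₂ j

CandyWithIsolated : (m n₁ n₂ r : ℕ) → Graph
CandyWithIsolated m n₁ n₂ r = record
  { V    = CandyV m n₁ n₂ r
  ; E    = CandyE m n₁ n₂
  ; end₁ = candyEnd₁
  ; end₂ = candyEnd₂
  }

-- The cliques of L(G) formed by the edges at v₁, the edges at v₂, and a pair v₁wᵢ, v₂wᵢ give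
-- ω ≥ m + n₁, m + n₂, 2. With fewer than ω colours Alice cannot win, because a complete position
-- colours such a clique properly. With k ≥ max(m + n₁, m + n₂, 2) colours Alice wins:
--  * if n₁ = n₂ she mirrors. She fixes a bijection between the edges at v₁ and those at v₂ that
--    never pairs v₁wᵢ with v₂wᵢ, and answers each move by the same colour on the paired edge.
--    Then v₁ and v₂ always carry the same colours, so an uncoloured edge sees only the colours
--    at its own hub, fewer than k. (If m + n₁ ≤ 1 there are just two edges.)
--  * if n₁ > n₂ only a spoke v₁wᵢ can get stuck, seeing the colours at v₁ and that of v₂wᵢ.
--    Alice keeps every colour of such a v₂wᵢ present at v₁: when Bob puts a new colour on v₂wᵢ
--    she repeats it on another uncoloured edge at v₁, and she never leaves v₁wᵢ as the only
--    uncoloured edge at v₁ while v₂wᵢ is uncoloured.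

module Submission where

open import Defs
open import Data.Nat using (ℕ; zero; suc; _+_; _≤_; _<_; z≤n; s≤s; _≤?_)
import Data.Nat as ℕ
open import Data.Nat.Properties
  using (≤-reflexive; ≤-trans; ≤-pred; <-irrefl; <⇒≱; ≰⇒>; <-cmp; n≤1+n; 1+n≢n;
         +-identityʳ; +-suc; +-monoʳ-≤; +-monoʳ-<; +-mono-≤; +-cancelˡ-<)
open import Data.Fin as Fin using (Fin)
import Data.Fin.Properties as Fin
open import Data.Fin.Permutation using (Permutation′; permutation; _⟨$⟩ʳ_; _⟨$⟩ˡ_; inverseˡ; inverseʳ)
open import Data.List using (List; []; _∷_; _++_; length; tabulate)
open import Data.List.Properties using (length-++; length-tabulate; length-removeAt′)
open import Data.List.Membership.Propositional using (_∈_; _∉_; find; lose)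
open import Data.List.Membership.Propositional.Properties using (∈-allFin; ∈-tabulate⁺; ∈-tabulate⁻; ∈-++⁺ˡ; ∈-++⁺ʳ)
import Data.List.Membership.DecPropositional as DecMembership
open import Data.List.Relation.Unary.Any as Any using (Any; here; there; _─_)
open import Data.List.Relation.Unary.All as All using (All; []; _∷_)
open import Data.List.Relation.Unary.AllPairs as AllPairs using (AllPairs; []; _∷_)
import Data.List.Relation.Unary.Unique.Propositional.Properties as Unique
import Data.List.Relation.Unary.AllPairs.Properties as AllPairs
open import Data.Product using (∃; ∃₂; _×_; _,_; proj₁; proj₂)
open import Data.Product.Properties using (≡-dec)
open import Data.Sum using (_⊎_; inj₁; inj₂; [_,_]′; map₂)
open import Data.Empty using (⊥; ⊥-elim)
open import Data.Unit using (⊤; tt)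
open import Relation.Nullary using (¬_; Dec; yes; no)
open import Relation.Nullary.Decidable using (¬?; _×-dec_; map′; decidable-stable)
open import Relation.Unary using (Decidable)
open import Relation.Binary.Definitions using (DecidableEquality; tri<; tri≈; tri>)
open import Relation.Binary.PropositionalEquality
open import Function using (_∘_; case_of_)

module _ {A : Set} where

  ∈-─ : ∀ {x y : A} {xs} (x∈xs : x ∈ xs) → y ∈ xs → y ≢ x → y ∈ (xs ─ x∈xs)
  ∈-─ (here refl)  (here refl)  y≢x = ⊥-elim (y≢x refl)
  ∈-─ (here refl)  (there y∈xs) _   = y∈xs
  ∈-─ (there x∈xs) (here refl)  _   = here refl
  ∈-─ (there x∈xs) (there y∈xs) y≢x = there (∈-─ x∈xs y∈xs y≢x)

  ∃∈? : {P : A → Set} → Decidable P → ∀ xs → Dec (∃ λ x → x ∈ xs × P x)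
  ∃∈? P? xs = map′ find (λ (_ , x∈xs , px) → lose x∈xs px) (Any.any? P? xs)

module _ {A B : Set} (M : A → B → Set) where

  matching⇒length≤ : ∀ {xs ys} →
    AllPairs (λ x x′ → ∀ {y} → M x y → M x′ y → ⊥) xs →
    All (λ x → ∃ λ y → y ∈ ys × M x y) xs →
    length xs ≤ length ys
  matching⇒length≤ [] [] = z≤n
  matching⇒length≤ {ys = ys} (x-apart ∷ apart) ((y , y∈ys , Mxy) ∷ matched) =
    subst (suc _ ≤_) (sym (length-removeAt′ ys (Any.index y∈ys)))
      (s≤s (matching⇒length≤ apart (All.zipWith rematch (x-apart , matched))))
    where
    rematch : ∀ {x′} → (∀ {y′} → M _ y′ → M x′ y′ → ⊥) × (∃ λ y′ → y′ ∈ ys × M x′ y′) →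
              ∃ λ y′ → y′ ∈ (ys ─ y∈ys) × M x′ y′
    rematch (apart′ , y′ , y′∈ys , Mx′y′) =
      y′ , ∈-─ y∈ys y′∈ys (λ { refl → apart′ Mxy Mx′y′ }) , Mx′y′

adjacent-sym : ∀ {G e f} → Adjacent G e f → Adjacent G f e
adjacent-sym (e≢f , inj₁ eq)               = e≢f ∘ sym , inj₁ (sym eq)
adjacent-sym (e≢f , inj₂ (inj₁ eq))        = e≢f ∘ sym , inj₂ (inj₂ (inj₁ (sym eq)))
adjacent-sym (e≢f , inj₂ (inj₂ (inj₁ eq))) = e≢f ∘ sym , inj₂ (inj₁ (sym eq))
adjacent-sym (e≢f , inj₂ (inj₂ (inj₂ eq))) = e≢f ∘ sym , inj₂ (inj₂ (inj₂ (sym eq)))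

module Game (G : Graph) (k : ℕ) (_≟E_ : DecidableEquality (E G))
            (edges : List (E G)) (∈-edges : ∀ e → e ∈ edges) where

  open DecMembership (≡-dec _≟E_ (λ {_} → Fin._≟_ {k})) using (_∈?_)

  record Proper (p : Position G k) : Set where
    field
      once     : AllPairs (λ x y → proj₁ x ≢ proj₁ y) p
      properly : ∀ {e f c} → (e , c) ∈ p → (f , c) ∈ p → ¬ Adjacent G e f

  open Proper public

  proper-[] : Proper []
  proper-[] = record { once = [] ; properly = λ () }

  proper-∷ : ∀ {p e c} → Proper p → Legal G p e c → Proper ((e , c) ∷ p)
  proper-∷ {p} {e} {c} pp (uncoloured , free) = record
    { once     = All.tabulate (λ { {_ , d} m refl → uncoloured (d , m) }) ∷ once pp
    ; properly = properly′
    }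
    where
    properly′ : ∀ {f g d} → (f , d) ∈ ((e , c) ∷ p) → (g , d) ∈ ((e , c) ∷ p) → ¬ Adjacent G f g
    properly′ (here refl) (here refl) adj = proj₁ adj refl
    properly′ (here refl) (there m)   adj = free _ adj m
    properly′ (there m)   (here refl) adj = free _ (adjacent-sym adj) m
    properly′ (there m)   (there m′)  adj = properly pp m m′ adj

  colour-functional : ∀ {p} → Proper p → ∀ {e c d} → (e , c) ∈ p → (e , d) ∈ p → c ≡ d
  colour-functional pp = go (once pp)
    where
    go : ∀ {p} → AllPairs (λ x y → proj₁ x ≢ proj₁ y) p →
         ∀ {e c d} → (e , c) ∈ p → (e , d) ∈ p → c ≡ d
    go (_     ∷ _)    (here refl) (here refl) = refl
    go (fresh ∷ _)    (here refl) (there m)   = ⊥-elim (All.lookup fresh m refl)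
    go (fresh ∷ _)    (there m)   (here refl) = ⊥-elim (All.lookup fresh m refl)
    go (_     ∷ once) (there m)   (there m′)  = go once m m′

  coloured-there : ∀ {p : Position G k} {e x} → Coloured G p e → Coloured G (x ∷ p) e
  coloured-there (c , m) = c , there m

  coloured-back : ∀ {p : Position G k} {e f c} → Coloured G ((f , c) ∷ p) e → e ≢ f → Coloured G p e
  coloured-back (_ , here refl) e≢f = ⊥-elim (e≢f refl)
  coloured-back (d , there m)   _   = d , m

  coloured? : ∀ (p : Position G k) e → Dec (Coloured G p e)
  coloured? p e =
    map′ (λ { ((_ , c) , m , refl) → c , m }) (λ (c , m) → _ , m , refl)
         (∃∈? (λ x → proj₁ x ≟E e) p)

  complete? : ∀ (p : Position G k) → Complete G p ⊎ ∃ λ e → ¬ Coloured G p e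
  complete? p with ∃∈? (λ e → ¬? (coloured? p e)) edges
  ... | yes (e , _ , uncoloured) = inj₂ (e , uncoloured)
  ... | no  none = inj₁ λ e →
    decidable-stable (coloured? p e) (λ uncoloured → none (e , ∈-edges e , uncoloured))

  length≤edges : ∀ {p} → Proper p → length p ≤ length edges
  length≤edges pp =
    matching⇒length≤ (λ x e → proj₁ x ≡ e)
      (AllPairs.map (λ x≢y {_} eq eq′ → x≢y (trans eq (sym eq′))) (once pp))
      (All.tabulate (λ {x} _ → proj₁ x , ∈-edges _ , refl))

  record Strategy (Inv : Position G k → Set) : Set where
    field
      colourable : ∀ {p} → Proper p → Inv p → ∀ {e} → ¬ Coloured G p e → ∃ (Legal G p e)
      reply      : ∀ {p e c} → Proper p → Inv p → Legal G p e c →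
                   Complete G ((e , c) ∷ p) ⊎
                   ∃₂ λ e′ c′ → Legal G ((e , c) ∷ p) e′ c′ × Inv ((e′ , c′) ∷ (e , c) ∷ p)

  strategy-wins : ∀ {Inv} → Strategy Inv → Inv [] → AliceWins G k
  strategy-wins {Inv} S inv[] = play (length edges) (≤-reflexive (sym (+-identityʳ _))) proper-[] inv[]
    where
    open Strategy S
    -- Each round colours two more edges and a proper position colours each edge once.
    play   : ∀ n {p} → length edges ≤ n + length p → Proper p → Inv p → WinBobTurn G k p
    answer : ∀ n {p} → length edges ≤ n + length p → Proper p → Inv p →
             ∀ e c → Legal G p e c → WinAliceTurn G k ((e , c) ∷ p)

    play n {p} bound pp inv with complete? p
    ... | inj₁ done             = finished done
    ... | inj₂ (e , uncoloured) =
      bobMoves (e , colourable pp inv uncoloured) (answer n bound pp inv)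

    answer zero bound pp inv e c legal =
      ⊥-elim (<-irrefl refl (≤-trans (length≤edges (proper-∷ pp legal)) bound))
    answer (suc n) {p} bound pp inv e c legal with reply pp inv legal
    ... | inj₁ done = finished done
    ... | inj₂ (e′ , c′ , legal′ , inv′) =
      aliceMoves e′ c′ legal′ (play n bound′ (proper-∷ (proper-∷ pp legal) legal′) inv′)
      where
      bound′ : length edges ≤ n + suc (suc (length p))
      bound′ = ≤-trans bound (≤-trans (s≤s (+-monoʳ-≤ n (n≤1+n _)))
                                      (≤-reflexive (sym (+-suc n (suc (length p))))))

  complete⇒clique≤colours : ∀ {p es} → Proper p → Complete G p → IsLineClique G es → length es ≤ k
  complete⇒clique≤colours {p} pp done clique =
    subst (_ ≤_) (length-tabulate (λ c → c))
      (matching⇒length≤ (λ e c → (e , c) ∈ p)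
        (AllPairs.map (λ adj {_} m m′ → properly pp m m′ adj) clique)
        (All.tabulate (λ {e} _ → proj₁ (done e) , ∈-allFin _ , proj₂ (done e))))

  module _ {es} (clique : IsLineClique G es) (k<es : k < length es) where

    ¬winBob   : ∀ {p} → Proper p → ¬ WinBobTurn G k p
    ¬winAlice : ∀ {p} → Proper p → ¬ WinAliceTurn G k p

    ¬winBob pp (finished done) = <⇒≱ k<es (complete⇒clique≤colours pp done clique)
    ¬winBob pp (bobMoves (e , c , legal) next) = ¬winAlice (proper-∷ pp legal) (next e c legal)

    ¬winAlice pp (finished done) = <⇒≱ k<es (complete⇒clique≤colours pp done clique)
    ¬winAlice pp (aliceMoves e c legal next) = ¬winBob (proper-∷ pp legal) next

  clique⇒¬AliceWins : ∀ {es} → IsLineClique G es → k < length es → ¬ AliceWins G k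
  clique⇒¬AliceWins clique k<es = ¬winBob clique k<es proper-[]

  legal-colour : ∀ {p e} → Proper p → ¬ Coloured G p e →
                 (N : List (E G)) → e ∈ N → length N ≤ k →
                 (∀ {g c} → Adjacent G e g → (g , c) ∈ p → Any (λ g′ → (g′ , c) ∈ p) N) →
                 ∃ (Legal G p e)
  legal-colour {p} {e} pp uncoloured N e∈N N≤k forbidden⇒used
    with Fin.any? (λ c → ¬? (Any.any? (λ g → (g , c) ∈? p) N))
  ... | yes (c , unused) = c , uncoloured , λ g adj m → unused (forbidden⇒used adj m)
  ... | no  all-used     = ⊥-elim (<-irrefl refl (≤-trans k<N N≤k))
    -- The k colours would occupy k distinct edges of N other than e.
    where
    other-edge-of : ∀ c → ∃ λ g → g ∈ (N ─ e∈N) × (g , c) ∈ p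
    other-edge-of c with find (decidable-stable (Any.any? (λ g → (g , c) ∈? p) N)
                                               (λ unused → all-used (c , unused)))
    ... | g , g∈N , m = g , ∈-─ e∈N g∈N (λ { refl → uncoloured (c , m) }) , m
    k<N : k < length N
    k<N = subst (k <_) (sym (length-removeAt′ N (Any.index e∈N)))
            (s≤s (subst (_≤ _) (length-tabulate (λ c → c))
              (matching⇒length≤ (λ c g → (g , c) ∈ p)
                (AllPairs.map (λ c≢d {_} m m′ → c≢d (colour-functional pp m m′)) (Unique.allFin⁺ k))
                (All.tabulate (λ {c} _ → other-edge-of c)))))

  enough-colours⇒AliceWins : length edges ≤ k → AliceWins G k
  enough-colours⇒AliceWins edges≤k = strategy-wins strategy tt
    where
    colourable : ∀ {p} → Proper p → ∀ {e} → ¬ Coloured G p e → ∃ (Legal G p e)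
    colourable pp {e} uncoloured =
      legal-colour pp uncoloured edges (∈-edges e) edges≤k (λ {g} _ m → lose (∈-edges g) m)
    strategy : Strategy (λ _ → ⊤)
    strategy = record
      { colourable = λ pp _ → colourable pp
      ; reply = λ {p} {e} {c} pp _ legal → map₂ (λ (e′ , uncoloured) →
          let c′ , legal′ = colourable (proper-∷ pp legal) uncoloured in e′ , c′ , legal′ , tt)
          (complete? ((e , c) ∷ p))
      }

-- An edge of a candy lies at v₁ (side L) or at v₂ (side R).
data Side : Set where
  L R : Side

opposite : Side → Side
opposite L = R
opposite R = L

_≟S_ : DecidableEquality Side
L ≟S L = yes refl
L ≟S R = no λ ()
R ≟S L = no λ ()
R ≟S R = yes refl

≢⇒opposite : ∀ {s t} → s ≢ t → s ≡ opposite t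
≢⇒opposite {L} {L} s≢t = ⊥-elim (s≢t refl)
≢⇒opposite {L} {R} _   = refl
≢⇒opposite {R} {L} _   = refl
≢⇒opposite {R} {R} s≢t = ⊥-elim (s≢t refl)

≢-opposite : ∀ s → s ≢ opposite s
≢-opposite L ()
≢-opposite R ()

opposite-involutive : ∀ s → opposite (opposite s) ≡ s
opposite-involutive L = refl
opposite-involutive R = refl

module Candy (m n₁ n₂ r : ℕ) where

  G : Graph
  G = CandyWithIsolated m n₁ n₂ r

  Edge : Set
  Edge = CandyE m n₁ n₂

  side : Edge → Side
  side (v₁w _)   = L
  side (pend₁ _) = L
  side (v₂w _)   = R
  side (pend₂ _) = R

  spoke : Side → Fin m → Edge
  spoke L = v₁w
  spoke R = v₂w

  leaves : Side → ℕ
  leaves L = n₁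
  leaves R = n₂

  pendant : (s : Side) → Fin (leaves s) → Edge
  pendant L = pend₁
  pendant R = pend₂

  data Partner : Edge → Edge → Set where
    v₁v₂ : ∀ i → Partner (v₁w i) (v₂w i)
    v₂v₁ : ∀ i → Partner (v₂w i) (v₁w i)

  _≟E_ : DecidableEquality Edge
  v₁w i   ≟E v₁w j   = map′ (cong v₁w) (λ { refl → refl }) (i Fin.≟ j)
  v₂w i   ≟E v₂w j   = map′ (cong v₂w) (λ { refl → refl }) (i Fin.≟ j)
  pend₁ i ≟E pend₁ j = map′ (cong pend₁) (λ { refl → refl }) (i Fin.≟ j)
  pend₂ i ≟E pend₂ j = map′ (cong pend₂) (λ { refl → refl }) (i Fin.≟ j)
  v₁w _   ≟E v₂w _   = no λ ()
  v₁w _   ≟E pend₁ _ = no λ ()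
  v₁w _   ≟E pend₂ _ = no λ ()
  v₂w _   ≟E v₁w _   = no λ ()
  v₂w _   ≟E pend₁ _ = no λ ()
  v₂w _   ≟E pend₂ _ = no λ ()
  pend₁ _ ≟E v₁w _   = no λ ()
  pend₁ _ ≟E v₂w _   = no λ ()
  pend₁ _ ≟E pend₂ _ = no λ ()
  pend₂ _ ≟E v₁w _   = no λ ()
  pend₂ _ ≟E v₂w _   = no λ ()
  pend₂ _ ≟E pend₁ _ = no λ ()

  hub : Side → CandyV m n₁ n₂ r
  hub L = v₁
  hub R = v₂

  end₁≡hub : ∀ e → candyEnd₁ e ≡ hub (side e)
  end₁≡hub (v₁w _)   = refl
  end₁≡hub (pend₁ _) = refl
  end₁≡hub (v₂w _)   = refl
  end₁≡hub (pend₂ _) = refl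

  hub-injective : ∀ {s t} → hub s ≡ hub t → s ≡ t
  hub-injective {L} {L} _ = refl
  hub-injective {R} {R} _ = refl

  hub≢end₂ : ∀ s e → hub s ≢ candyEnd₂ e
  hub≢end₂ L (v₁w _)   ()
  hub≢end₂ L (pend₁ _) ()
  hub≢end₂ L (v₂w _)   ()
  hub≢end₂ L (pend₂ _) ()
  hub≢end₂ R (v₁w _)   ()
  hub≢end₂ R (pend₁ _) ()
  hub≢end₂ R (v₂w _)   ()
  hub≢end₂ R (pend₂ _) ()

  shared-end₂ : ∀ e f → candyEnd₂ {r = r} e ≡ candyEnd₂ f → e ≡ f ⊎ Partner e f
  shared-end₂ (v₁w i)   (v₁w _)   refl = inj₁ refl
  shared-end₂ (v₁w i)   (v₂w _)   refl = inj₂ (v₁v₂ i)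
  shared-end₂ (v₂w i)   (v₁w _)   refl = inj₂ (v₂v₁ i)
  shared-end₂ (v₂w i)   (v₂w _)   refl = inj₁ refl
  shared-end₂ (pend₁ _) (pend₁ _) refl = inj₁ refl
  shared-end₂ (pend₂ _) (pend₂ _) refl = inj₁ refl
  shared-end₂ (v₁w _)   (pend₁ _) ()
  shared-end₂ (v₁w _)   (pend₂ _) ()
  shared-end₂ (v₂w _)   (pend₁ _) ()
  shared-end₂ (v₂w _)   (pend₂ _) ()
  shared-end₂ (pend₁ _) (v₁w _)   ()
  shared-end₂ (pend₁ _) (v₂w _)   ()
  shared-end₂ (pend₁ _) (pend₂ _) ()
  shared-end₂ (pend₂ _) (v₁w _)   ()
  shared-end₂ (pend₂ _) (v₂w _)   ()
  shared-end₂ (pend₂ _) (pend₁ _) ()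

  adjacent⇒ : ∀ {e f} → Adjacent G e f → side e ≡ side f ⊎ Partner e f
  adjacent⇒ {e} {f} (_ , inj₁ eq) =
    inj₁ (hub-injective (trans (sym (end₁≡hub e)) (trans eq (end₁≡hub f))))
  adjacent⇒ {e} {f} (_ , inj₂ (inj₁ eq)) =
    ⊥-elim (hub≢end₂ _ f (trans (sym (end₁≡hub e)) eq))
  adjacent⇒ {e} {f} (_ , inj₂ (inj₂ (inj₁ eq))) =
    ⊥-elim (hub≢end₂ _ e (trans (sym (end₁≡hub f)) (sym eq)))
  adjacent⇒ (e≢f , inj₂ (inj₂ (inj₂ eq))) = [ ⊥-elim ∘ e≢f , inj₂ ]′ (shared-end₂ _ _ eq)

  same-side⇒adjacent : ∀ {e f} → e ≢ f → side e ≡ side f → Adjacent G e f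
  same-side⇒adjacent {e} {f} e≢f eq =
    e≢f , inj₁ (trans (end₁≡hub e) (trans (cong hub eq) (sym (end₁≡hub f))))

  partner⇒adjacent : ∀ {e f} → Partner e f → Adjacent G e f
  partner⇒adjacent (v₁v₂ _) = (λ ()) , inj₂ (inj₂ (inj₂ refl))
  partner⇒adjacent (v₂v₁ _) = (λ ()) , inj₂ (inj₂ (inj₂ refl))

  partner-clique : ∀ {e f} → Partner e f → IsLineClique G (e ∷ f ∷ [])
  partner-clique partner = (partner⇒adjacent partner ∷ []) ∷ [] ∷ []

  partner-side : ∀ {e f} → Partner e f → side f ≡ opposite (side e)
  partner-side (v₁v₂ _) = refl
  partner-side (v₂v₁ _) = refl

  partner-injective : ∀ {e e′ f} → Partner e f → Partner e′ f → e ≡ e′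
  partner-injective (v₁v₂ _) (v₁v₂ _) = refl
  partner-injective (v₂v₁ _) (v₂v₁ _) = refl

  partner-sym : ∀ {e f} → Partner e f → Partner f e
  partner-sym (v₁v₂ i) = v₂v₁ i
  partner-sym (v₂v₁ i) = v₁v₂ i

  partner-or-self : Edge → Edge
  partner-or-self (v₁w i)   = v₂w i
  partner-or-self (v₂w i)   = v₁w i
  partner-or-self (pend₁ j) = pend₁ j
  partner-or-self (pend₂ j) = pend₂ j

  partner⇒partner-or-self : ∀ {e f} → Partner e f → f ≡ partner-or-self e
  partner⇒partner-or-self (v₁v₂ _) = refl
  partner⇒partner-or-self (v₂v₁ _) = refl

  side-spoke : ∀ s i → side (spoke s i) ≡ s
  side-spoke L _ = refl
  side-spoke R _ = refl

  spoke-injective : ∀ s {i j} → spoke s i ≡ spoke s j → i ≡ j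
  spoke-injective L refl = refl
  spoke-injective R refl = refl

  spoke-partner : ∀ s i → Partner (spoke s i) (spoke (opposite s) i)
  spoke-partner L = v₁v₂
  spoke-partner R = v₂v₁

  partner-at : ∀ {s e f} → Partner e f → side e ≡ s →
               ∃ λ i → e ≡ spoke s i × f ≡ spoke (opposite s) i
  partner-at (v₁v₂ i) refl = i , refl , refl
  partner-at (v₂v₁ i) refl = i , refl , refl

  side-pendant : ∀ s j → side (pendant s j) ≡ s
  side-pendant L _ = refl
  side-pendant R _ = refl

  pendant≢spoke : ∀ s j i → pendant s j ≢ spoke s i
  pendant≢spoke L _ _ ()
  pendant≢spoke R _ _ ()

  size : Side → ℕ
  size s = m + leaves s

  edgeAt : (s : Side) → Fin (size s) → Edge
  edgeAt s x = [ spoke s , pendant s ]′ (Fin.splitAt m x)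

  index : (e : Edge) → Fin (size (side e))
  index (v₁w i)   = i Fin.↑ˡ n₁
  index (pend₁ j) = m Fin.↑ʳ j
  index (v₂w i)   = i Fin.↑ˡ n₂
  index (pend₂ j) = m Fin.↑ʳ j

  edgeAt-index : ∀ e → edgeAt (side e) (index e) ≡ e
  edgeAt-index (v₁w i)   = cong [ v₁w , pend₁ ]′ (Fin.splitAt-↑ˡ m i n₁)
  edgeAt-index (pend₁ j) = cong [ v₁w , pend₁ ]′ (Fin.splitAt-↑ʳ m n₁ j)
  edgeAt-index (v₂w i)   = cong [ v₂w , pend₂ ]′ (Fin.splitAt-↑ˡ m i n₂)
  edgeAt-index (pend₂ j) = cong [ v₂w , pend₂ ]′ (Fin.splitAt-↑ʳ m n₂ j)

  side-edgeAt : ∀ s x → side (edgeAt s x) ≡ s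
  side-edgeAt L x with Fin.splitAt m x
  ... | inj₁ _ = refl
  ... | inj₂ _ = refl
  side-edgeAt R x with Fin.splitAt m x
  ... | inj₁ _ = refl
  ... | inj₂ _ = refl

  spoke-or-pendant-injective : ∀ s {a b : Fin m ⊎ Fin (leaves s)} →
    [ spoke s , pendant s ]′ a ≡ [ spoke s , pendant s ]′ b → a ≡ b
  spoke-or-pendant-injective L {inj₁ _} {inj₁ _} refl = refl
  spoke-or-pendant-injective L {inj₂ _} {inj₂ _} refl = refl
  spoke-or-pendant-injective R {inj₁ _} {inj₁ _} refl = refl
  spoke-or-pendant-injective R {inj₂ _} {inj₂ _} refl = refl

  edgeAt-injective : ∀ s {x y} → edgeAt s x ≡ edgeAt s y → x ≡ y
  edgeAt-injective s {x} {y} eq = begin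
    x                                   ≡⟨ Fin.join-splitAt m (leaves s) x ⟨
    Fin.join m _ (Fin.splitAt m x)
      ≡⟨ cong (Fin.join m _) (spoke-or-pendant-injective s {Fin.splitAt m x} {Fin.splitAt m y} eq) ⟩
    Fin.join m _ (Fin.splitAt m y)      ≡⟨ Fin.join-splitAt m (leaves s) y ⟩
    y                                   ∎
    where open ≡-Reasoning

  edgesAt : Side → List Edge
  edgesAt s = tabulate (edgeAt s)

  ∈-edgesAt : ∀ {s} e → side e ≡ s → e ∈ edgesAt s
  ∈-edgesAt e refl = subst (_∈ edgesAt (side e)) (edgeAt-index e) (∈-tabulate⁺ (index e))

  edgesAt-side : ∀ {s e} → e ∈ edgesAt s → side e ≡ s
  edgesAt-side {s} e∈ with ∈-tabulate⁻ e∈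
  ... | x , refl = side-edgeAt s x

  length-edgesAt : ∀ s → length (edgesAt s) ≡ size s
  length-edgesAt s = length-tabulate (edgeAt s)

  edgesAt-clique : ∀ s → IsLineClique G (edgesAt s)
  edgesAt-clique s = AllPairs.tabulate⁺ λ {x} {y} x≢y →
    same-side⇒adjacent (x≢y ∘ edgeAt-injective s) (trans (side-edgeAt s x) (sym (side-edgeAt s y)))

  edges : List Edge
  edges = edgesAt L ++ edgesAt R

  ∈-edges : ∀ e → e ∈ edges
  ∈-edges (v₁w i)   = ∈-++⁺ˡ (∈-edgesAt (v₁w i) refl)
  ∈-edges (pend₁ j) = ∈-++⁺ˡ (∈-edgesAt (pend₁ j) refl)
  ∈-edges (v₂w i)   = ∈-++⁺ʳ (edgesAt L) (∈-edgesAt (v₂w i) refl)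
  ∈-edges (pend₂ j) = ∈-++⁺ʳ (edgesAt L) (∈-edgesAt (pend₂ j) refl)

  length-edges : length edges ≡ size L + size R
  length-edges = trans (length-++ (edgesAt L)) (cong₂ _+_ (length-edgesAt L) (length-edgesAt R))

  module Play (k : ℕ) where

    open Game G k _≟E_ edges ∈-edges public

    UsedOn : Side → Position G k → Fin k → Set
    UsedOn s p c = ∃ λ f → side f ≡ s × (f , c) ∈ p

    usedOn? : ∀ s p c → Dec (UsedOn s p c)
    usedOn? s p c =
      map′ (λ { ((f , _) , m , sf , refl) → f , sf , m }) (λ (f , sf , m) → _ , m , sf , refl)
           (∃∈? (λ x → side (proj₁ x) ≟S s ×-dec proj₂ x Fin.≟ c) p)

    usedOn-there : ∀ {s p c x} → UsedOn s p c → UsedOn s (x ∷ p) c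
    usedOn-there (f , sf , m) = f , sf , there m

rotate : ∀ {d} → Fin (suc d) → Fin (suc d)
rotate Fin.zero    = Fin.fromℕ _
rotate (Fin.suc i) = Fin.inject₁ i

unrotate : ∀ {d} → Fin (suc d) → Fin (suc d)
unrotate {d} i with d ℕ.≟ Fin.toℕ i
... | yes _   = Fin.zero
... | no  d≢i = Fin.suc (Fin.lower₁ i d≢i)

rotate-unrotate : ∀ {d} (y : Fin (suc d)) → rotate (unrotate y) ≡ y
rotate-unrotate {d} y with d ℕ.≟ Fin.toℕ y
... | yes d≡y = Fin.toℕ-injective (trans (Fin.toℕ-fromℕ d) d≡y)
... | no  d≢y = Fin.inject₁-lower₁ y d≢y

unrotate-rotate : ∀ {d} (x : Fin (suc d)) → unrotate (rotate x) ≡ x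
unrotate-rotate {d} Fin.zero with d ℕ.≟ Fin.toℕ (Fin.fromℕ d)
... | yes _   = refl
... | no  d≢d = ⊥-elim (d≢d (sym (Fin.toℕ-fromℕ d)))
unrotate-rotate {suc d} (Fin.suc i) with suc d ℕ.≟ Fin.toℕ (Fin.inject₁ i)
... | yes d≡i = ⊥-elim (Fin.toℕ-inject₁-≢ i d≡i)
... | no  d≢i = cong Fin.suc (Fin.lower₁-inject₁′ i d≢i)

rotate-fixed-point-free : ∀ {d} (x : Fin (suc (suc d))) → rotate x ≢ x
rotate-fixed-point-free Fin.zero    ()
rotate-fixed-point-free (Fin.suc i) eq =
  1+n≢n (sym (trans (sym (Fin.toℕ-inject₁ i)) (cong Fin.toℕ eq)))

derangement : ∀ d → 2 ≤ d → ∃ λ (π : Permutation′ d) → ∀ x → π ⟨$⟩ʳ x ≢ x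
derangement (suc zero) (s≤s ())
derangement (suc (suc d)) _ =
  permutation rotate unrotate rotate-unrotate unrotate-rotate , rotate-fixed-point-free

module Mirror (m n r k : ℕ) (m+n≤k : m + n ≤ k)
              (π : Permutation′ (m + n)) (π-fpf : ∀ x → π ⟨$⟩ʳ x ≢ x) where

  open Candy m n n r
  open Play k

  -- index e, at a type that no longer depends on side e.
  ix : Edge → Fin (m + n)
  ix (v₁w i)   = index (v₁w i)
  ix (pend₁ j) = index (pend₁ j)
  ix (v₂w i)   = index (v₂w i)
  ix (pend₂ j) = index (pend₂ j)

  edge : Side → Fin (m + n) → Edge
  edge L = edgeAt L
  edge R = edgeAt R

  edge-ix : ∀ e → edge (side e) (ix e) ≡ e
  edge-ix (v₁w i)   = edgeAt-index (v₁w i)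
  edge-ix (pend₁ j) = edgeAt-index (pend₁ j)
  edge-ix (v₂w i)   = edgeAt-index (v₂w i)
  edge-ix (pend₂ j) = edgeAt-index (pend₂ j)

  side-edge : ∀ s x → side (edge s x) ≡ s
  side-edge L = side-edgeAt L
  side-edge R = side-edgeAt R

  edge-injective : ∀ s {x y} → edge s x ≡ edge s y → x ≡ y
  edge-injective L = edgeAt-injective L
  edge-injective R = edgeAt-injective R

  ix-edge : ∀ s x → ix (edge s x) ≡ x
  ix-edge s x = edge-injective s
    (trans (cong (λ t → edge t (ix (edge s x))) (sym (side-edge s x))) (edge-ix (edge s x)))

  partner-ix : ∀ {e f} → Partner e f → ix e ≡ ix f
  partner-ix (v₁v₂ _) = refl
  partner-ix (v₂v₁ _) = refl

  turn : Side → Fin (m + n) → Fin (m + n)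
  turn L = π ⟨$⟩ʳ_
  turn R = π ⟨$⟩ˡ_

  turn-opposite : ∀ s x → turn (opposite s) (turn s x) ≡ x
  turn-opposite L _ = inverseˡ π
  turn-opposite R _ = inverseʳ π

  turn-fixed-point-free : ∀ s x → turn s x ≢ x
  turn-fixed-point-free L x = π-fpf x
  turn-fixed-point-free R x eq = π-fpf x (trans (sym (cong (π ⟨$⟩ʳ_) eq)) (inverseʳ π))

  -- Alice answers a colour on e by the same colour on mirror e.
  mirror : Edge → Edge
  mirror e = edge (opposite (side e)) (turn (side e) (ix e))

  side-mirror : ∀ e → side (mirror e) ≡ opposite (side e)
  side-mirror e = side-edge _ _

  mirror-involutive : ∀ e → mirror (mirror e) ≡ e
  mirror-involutive e = begin
    mirror (mirror e)
      ≡⟨ cong₂ (λ t x → edge (opposite t) (turn t x)) (side-mirror e) (ix-edge (opposite (side e)) _) ⟩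
    edge (opposite (opposite (side e))) (turn (opposite (side e)) (turn (side e) (ix e)))
      ≡⟨ cong₂ edge (opposite-involutive (side e)) (turn-opposite (side e) (ix e)) ⟩
    edge (side e) (ix e)
      ≡⟨ edge-ix e ⟩
    e ∎
    where open ≡-Reasoning

  mirror-not-adjacent : ∀ e → ¬ Adjacent G e (mirror e)
  mirror-not-adjacent e adj with adjacent⇒ adj
  ... | inj₁ same    = ≢-opposite (side e) (trans same (side-mirror e))
  ... | inj₂ partner =
    turn-fixed-point-free (side e) (ix e) (sym (trans (partner-ix partner) (ix-edge (opposite (side e)) _)))

  record Symmetric (p : Position G k) : Set where
    field
      mirrored : ∀ {e} → Coloured G p e → Coloured G p (mirror e)
      balanced : ∀ {s t c} → UsedOn s p c → UsedOn t p c

  open Symmetric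

  symmetric-[] : Symmetric []
  symmetric-[] = record { mirrored = λ { (_ , ()) } ; balanced = λ { (_ , _ , ()) } }

  size≤k : ∀ s → size s ≤ k
  size≤k L = m+n≤k
  size≤k R = m+n≤k

  colourable : ∀ {p} → Proper p → Symmetric p → ∀ {e} → ¬ Coloured G p e → ∃ (Legal G p e)
  colourable pp symm {e} uncoloured =
    legal-colour pp uncoloured (edgesAt (side e)) (∈-edgesAt e refl)
      (subst (_≤ k) (sym (length-edgesAt (side e))) (size≤k (side e)))
      (λ {g} _ m → let f , sf , mf = balanced symm (g , refl , m) in lose (∈-edgesAt f sf) mf)

  -- A colour in use occurs on both sides, so in particular next to e.
  unused-colour : ∀ {p e c} → Symmetric p → Legal G p e c → ∀ g → (g , c) ∉ p
  unused-colour {e = e} symm (uncoloured , free) g m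
    with f , sf , mf ← balanced symm {t = side e} (g , refl , m) =
    free f (same-side⇒adjacent (λ { refl → uncoloured (_ , mf) }) (sym sf)) mf

  mirror-legal : ∀ {p e c} → Symmetric p → Legal G p e c → Legal G ((e , c) ∷ p) (mirror e) c
  mirror-legal {p} {e} {c} symm legal = uncoloured′ , free′
    where
    uncoloured′ : ¬ Coloured G ((e , c) ∷ p) (mirror e)
    uncoloured′ (_ , here eq) =
      ≢-opposite (side e) (trans (cong side (sym (cong proj₁ eq))) (side-mirror e))
    uncoloured′ (d , there m) =
      proj₁ legal (subst (Coloured G p) (mirror-involutive e) (mirrored symm (d , m)))
    free′ : ∀ g → Adjacent G (mirror e) g → (g , c) ∉ ((e , c) ∷ p)
    free′ g adj (here refl) = mirror-not-adjacent e (adjacent-sym {G} adj)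
    free′ g adj (there m)   = unused-colour symm legal g m

  symmetric-∷ : ∀ {p e c} → Symmetric p → Symmetric ((mirror e , c) ∷ (e , c) ∷ p)
  symmetric-∷ {p} {e} {c} symm = record { mirrored = mirrored′ ; balanced = balanced′ }
    where
    p″ = (mirror e , c) ∷ (e , c) ∷ p

    mirrored′ : ∀ {e′} → Coloured G p″ e′ → Coloured G p″ (mirror e′)
    mirrored′ (_ , here refl) =
      subst (Coloured G p″) (sym (mirror-involutive e)) (c , there (here refl))
    mirrored′ (_ , there (here refl)) = c , here refl
    mirrored′ (d , there (there m)) =
      let d′ , m′ = mirrored symm (d , m) in d′ , there (there m′)

    used-everywhere : ∀ t → UsedOn t p″ c
    used-everywhere t with t ≟S side e
    ... | yes refl = e , refl , there (here refl)
    ... | no  t≢e  = mirror e , trans (side-mirror e) (sym (≢⇒opposite t≢e)) , here refl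

    balanced′ : ∀ {s t c′} → UsedOn s p″ c′ → UsedOn t p″ c′
    balanced′ {t = t} (_ , _ , here refl)         = used-everywhere t
    balanced′ {t = t} (_ , _ , there (here refl)) = used-everywhere t
    balanced′ (f , sf , there (there m)) =
      let g , sg , mg = balanced symm (f , sf , m) in g , sg , there (there mg)

  mirror-wins : AliceWins G k
  mirror-wins = strategy-wins strategy symmetric-[]
    where
    strategy : Strategy Symmetric
    strategy = record
      { colourable = colourable
      ; reply      = λ {e = e} _ symm legal →
                       inj₂ (mirror e , _ , mirror-legal symm legal , symmetric-∷ symm)
      }

module Lopsided (m n₁ n₂ r k : ℕ) (s : Side)
                (s≤k : Candy.size m n₁ n₂ r s ≤ k)
                (t<s : Candy.size m n₁ n₂ r (opposite s) < Candy.size m n₁ n₂ r s) where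

  open Candy m n₁ n₂ r
  open Play k

  t : Side
  t = opposite s

  s≢t : s ≢ t
  s≢t = ≢-opposite s

  -- Then every colour seen by an uncoloured spoke s i occurs at hub s, so fewer than k do.
  Guarded : Position G k → Set
  Guarded p = ∀ i c → ¬ Coloured G p (spoke s i) → (spoke t i , c) ∈ p → UsedOn s p c

  -- Bob could now put a colour absent at hub s on spoke t i, leaving Alice no other edge at s
  -- to repeat it on.
  Lonely : Position G k → Fin m → Set
  Lonely p i = ¬ Coloured G p (spoke s i) × ¬ Coloured G p (spoke t i) ×
               (∀ f → side f ≡ s → f ≢ spoke s i → Coloured G p f)

  Safe : Position G k → Set
  Safe p = Guarded p × (∀ i → ¬ Lonely p i)

  guarded-∷ : ∀ {p e c} → Guarded p →
              (∀ i → e ≡ spoke t i → ¬ Coloured G p (spoke s i) → UsedOn s p c) →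
              Guarded ((e , c) ∷ p)
  guarded-∷ guarded new i _ uncoloured (here refl) =
    usedOn-there (new i refl (uncoloured ∘ coloured-there))
  guarded-∷ guarded new i c uncoloured (there m) =
    usedOn-there (guarded i c (uncoloured ∘ coloured-there) m)

  guarded-∷-s : ∀ {p e c} → side e ≡ s → Guarded p → Guarded ((e , c) ∷ p)
  guarded-∷-s e∈s guarded =
    guarded-∷ guarded λ { i refl _ → ⊥-elim (s≢t (trans (sym e∈s) (side-spoke t i))) }

  colourable : ∀ {p} → Proper p → Guarded p → ∀ {e} → ¬ Coloured G p e → ∃ (Legal G p e)
  colourable {p} pp guarded {e} uncoloured with side e ≟S s
  ... | yes e∈s =
    legal-colour pp uncoloured (edgesAt s) (∈-edgesAt e e∈s)
      (subst (_≤ k) (sym (length-edgesAt s)) s≤k) forbidden⇒used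
    where
    forbidden⇒used : ∀ {g c} → Adjacent G e g → (g , c) ∈ p → Any (λ g′ → (g′ , c) ∈ p) (edgesAt s)
    forbidden⇒used {g} {c} adj m with adjacent⇒ adj
    ... | inj₁ same = lose (∈-edgesAt g (trans (sym same) e∈s)) m
    ... | inj₂ partner with partner-at partner e∈s
    ...   | i , refl , refl with guarded i c uncoloured m
    ...     | f , f∈s , mf = lose (∈-edgesAt f f∈s) mf
  ... | no e∉s =
    legal-colour pp uncoloured (partner-or-self e ∷ edgesAt t) (there (∈-edgesAt e (≢⇒opposite e∉s)))
      (≤-trans (s≤s (≤-reflexive (length-edgesAt t))) (≤-trans t<s s≤k)) forbidden⇒used
    where
    forbidden⇒used : ∀ {g c} → Adjacent G e g → (g , c) ∈ p →
                     Any (λ g′ → (g′ , c) ∈ p) (partner-or-self e ∷ edgesAt t)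
    forbidden⇒used {g} adj m with adjacent⇒ adj
    ... | inj₁ same    = there (lose (∈-edgesAt g (trans (sym same) (≢⇒opposite e∉s))) m)
    ... | inj₂ partner = here (subst (λ g′ → (g′ , _) ∈ p) (partner⇒partner-or-self partner) m)

  others-coloured? : ∀ p x → (∀ f → side f ≡ s → f ≢ x → Coloured G p f) ⊎
                              ∃ λ f → side f ≡ s × f ≢ x × ¬ Coloured G p f
  others-coloured? p x with ∃∈? (λ f → ¬? (f ≟E x) ×-dec ¬? (coloured? p f)) (edgesAt s)
  ... | yes (f , f∈s , f≢x , uncoloured) = inj₂ (f , edgesAt-side f∈s , f≢x , uncoloured)
  ... | no  none = inj₁ λ f f∈s f≢x →
    decidable-stable (coloured? p f) (λ uncoloured → none (f , ∈-edgesAt f f∈s , f≢x , uncoloured))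

  lonely? : ∀ p i → Dec (Lonely p i)
  lonely? p i with others-coloured? p (spoke s i)
  ... | inj₁ others = map′ (λ (u , u′) → u , u′ , others) (λ (u , u′ , _) → u , u′)
                           (¬? (coloured? p (spoke s i)) ×-dec ¬? (coloured? p (spoke t i)))
  ... | inj₂ (f , f∈s , f≢x , uncoloured) = no λ (_ , _ , others) → uncoloured (others f f∈s f≢x)

  Matches : Position G k → Edge → Edge → Set
  Matches p a b = (¬ Coloured G p a × Partner a b × ¬ Coloured G p b) ⊎
                  (∃ λ c → (a , c) ∈ p × (b , c) ∈ p)

  matches-apart : ∀ {p a a′ b} → Proper p → Adjacent G a a′ → Matches p a b → Matches p a′ b → ⊥
  matches-apart pp adj (inj₁ (_ , pa , _)) (inj₁ (_ , pa′ , _)) = proj₁ adj (partner-injective pa pa′)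
  matches-apart pp adj (inj₁ (_ , _ , ub)) (inj₂ (c , _ , mb))  = ub (c , mb)
  matches-apart pp adj (inj₂ (c , _ , mb)) (inj₁ (_ , _ , ub))  = ub (c , mb)
  matches-apart {p} pp adj (inj₂ (c , ma , mb)) (inj₂ (c′ , ma′ , mb′)) =
    properly pp ma (subst (λ d → (_ , d) ∈ p) (sym (colour-functional pp mb mb′)) ma′) adj

  -- Otherwise Matches would inject the edges at hub s into the fewer edges at hub t.
  colour-missing-at-t : ∀ {p} → Proper p →
    (∀ a → side a ≡ s → ¬ Coloured G p a → ∃ λ b → Partner a b × ¬ Coloured G p b) →
    ∃ λ d → UsedOn s p d × ¬ UsedOn t p d
  colour-missing-at-t {p} pp partners-uncoloured
    with Fin.any? (λ d → usedOn? s p d ×-dec ¬? (usedOn? t p d))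
  ... | yes found = found
  ... | no  none  = ⊥-elim (<⇒≱ t<s
    (subst₂ _≤_ (length-edgesAt s) (length-edgesAt t)
      (matching⇒length≤ (Matches p) (AllPairs.map (λ adj {_} → matches-apart pp adj) (edgesAt-clique s))
        (All.tabulate witness))))
    where
    witness : ∀ {a} → a ∈ edgesAt s → ∃ λ b → b ∈ edgesAt t × Matches p a b
    witness {a} a∈s with coloured? p a
    ... | yes (c , ma)
      with b , b∈t , mb ← decidable-stable (usedOn? t p c)
                             (λ unused → none (c , (a , edgesAt-side a∈s , ma) , unused))
      = b , ∈-edgesAt b b∈t , inj₂ (c , ma , mb)
    ... | no ua with b , partner , ub ← partners-uncoloured a (edgesAt-side a∈s) ua
      = b , ∈-edgesAt b (trans (partner-side partner) (cong opposite (edgesAt-side a∈s)))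
          , inj₁ (ua , partner , ub)

  Move : Position G k → Set
  Move q = ∃₂ λ e c → Legal G q e c × Safe ((e , c) ∷ q)

  spoke-s≢spoke-t : ∀ i j → spoke s i ≢ spoke t j
  spoke-s≢spoke-t i j eq = s≢t (trans (sym (side-spoke s i)) (trans (cong side eq) (side-spoke t j)))

  -- Colouring f would leave spoke s l lonely.
  module Critical {q f l} (pq : Proper q) (gq : Guarded q)
                  (f≢l : f ≢ spoke s l) (uf : ¬ Coloured G q f)
                  (ul : ¬ Coloured G q (spoke s l)) (utl : ¬ Coloured G q (spoke t l))
                  (rest : ∀ g → side g ≡ s → g ≢ spoke s l → g ≢ f → Coloured G q g) where

    uncoloured-at-s : ∀ g → side g ≡ s → ¬ Coloured G q g → g ≡ f ⊎ g ≡ spoke s l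
    uncoloured-at-s g g∈s ug with g ≟E spoke s l | g ≟E f
    ... | yes g≡l | _       = inj₂ g≡l
    ... | no  _   | yes g≡f = inj₁ g≡f
    ... | no  g≢l | no  g≢f = ⊥-elim (ug (rest g g∈s g≢l g≢f))

    colour-spoke-s-l : (∀ j → f ≡ spoke s j → Coloured G q (spoke t j)) → Move q
    colour-spoke-s-l settled =
      spoke s l , c , legal , guarded-∷-s (side-spoke s l) gq , not-lonely
      where
      c = proj₁ (colourable pq gq ul)
      legal = proj₂ (colourable pq gq ul)
      not-lonely : ∀ i → ¬ Lonely ((spoke s l , c) ∷ q) i
      not-lonely i (ui , uti , _) with uncoloured-at-s (spoke s i) (side-spoke s i) (ui ∘ coloured-there)
      ... | inj₁ i≡f = uti (coloured-there (settled i (sym i≡f)))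
      ... | inj₂ i≡l = ui (c , here (cong (_, c) i≡l))

    colour-spoke-t-j : ∀ j → f ≡ spoke s j → ¬ Coloured G q (spoke t j) → Move q
    colour-spoke-t-j j refl utj = move (colour-missing-at-t pq partners-uncoloured)
      where
      partners-uncoloured : ∀ a → side a ≡ s → ¬ Coloured G q a →
                            ∃ λ b → Partner a b × ¬ Coloured G q b
      partners-uncoloured a a∈s ua with uncoloured-at-s a a∈s ua
      ... | inj₁ refl = spoke t j , spoke-partner s j , utj
      ... | inj₂ refl = spoke t l , spoke-partner s l , utl

      move : (∃ λ d → UsedOn s q d × ¬ UsedOn t q d) → Move q
      move (d , used-s , unused-t) =
        spoke t j , d , (utj , free) , guarded-∷ gq (λ _ _ _ → used-s) , not-lonely
        where
        free : ∀ g → Adjacent G (spoke t j) g → (g , d) ∉ q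
        free g adj m with adjacent⇒ adj
        ... | inj₁ same    = unused-t (g , trans (sym same) (side-spoke t j) , m)
        ... | inj₂ partner =
          uf (d , subst (λ g′ → (g′ , d) ∈ q)
                        (partner-injective (partner-sym partner) (spoke-partner s j)) m)
        not-lonely : ∀ i → ¬ Lonely ((spoke t j , d) ∷ q) i
        not-lonely i (_ , _ , others) with spoke s i ≟E spoke s j
        ... | yes i≡j =
          ul (coloured-back (others (spoke s l) (side-spoke s l) (λ l≡i → f≢l (trans (sym i≡j) (sym l≡i))))
                            (spoke-s≢spoke-t l j))
        ... | no  i≢j =
          uf (coloured-back (others (spoke s j) (side-spoke s j) (i≢j ∘ sym)) (spoke-s≢spoke-t j j))

  critical-move : ∀ {q f c l} → Proper q → Guarded q → ¬ Coloured G q f →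
                  Lonely ((f , c) ∷ q) l → Move q
  critical-move {q} {f} {c} {l} pq gq uf (ul , utl , others) =
    choose (Fin.any? (λ j → (f ≟E spoke s j) ×-dec ¬? (coloured? q (spoke t j))))
    where
    f≢l : f ≢ spoke s l
    f≢l refl = ul (c , here refl)
    open Critical pq gq f≢l uf (ul ∘ coloured-there) (utl ∘ coloured-there)
                  (λ g g∈s g≢l g≢f → coloured-back (others g g∈s g≢l) g≢f)
    choose : Dec (∃ λ j → f ≡ spoke s j × ¬ Coloured G q (spoke t j)) → Move q
    choose (yes (j , f≡j , utj)) = colour-spoke-t-j j f≡j utj
    choose (no  settled) = colour-spoke-s-l λ j f≡j →
      decidable-stable (coloured? q (spoke t j)) (λ utj → settled (j , f≡j , utj))

  colour-s-edge : ∀ {q f} → Proper q → Guarded q → side f ≡ s → ¬ Coloured G q f → Move q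
  colour-s-edge {q} {f} pq gq f∈s uf with colourable pq gq uf
  ... | c , legal with Fin.any? (lonely? ((f , c) ∷ q))
  ...   | no  none         = f , c , legal , guarded-∷-s f∈s gq , λ i lonely → none (i , lonely)
  ...   | yes (l , lonely) = critical-move pq gq uf lonely

  guarded-move : ∀ {q} → Proper q → Guarded q → Complete G q ⊎ Move q
  guarded-move {q} pq gq with ∃∈? (λ f → ¬? (coloured? q f)) (edgesAt s)
  ... | yes (f , f∈s , uf) = inj₂ (colour-s-edge pq gq (edgesAt-side f∈s) uf)
  ... | no  s-done with complete? q
  ...   | inj₁ done = inj₁ done
  ...   | inj₂ (e , ue) with c , legal ← colourable pq gq ue =
    inj₂ (e , c , legal , (λ i _ u _ → ⊥-elim (u (spoke-coloured i))) , λ i (u , _) → u (spoke-coloured i))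
    where
    spoke-coloured : ∀ i → Coloured G ((e , c) ∷ q) (spoke s i)
    spoke-coloured i = coloured-there (decidable-stable (coloured? q (spoke s i))
      (λ u → s-done (spoke s i , ∈-edgesAt (spoke s i) (side-spoke s i) , u)))

  threat-reply : ∀ {p i c} → Proper p → Safe p → Legal G p (spoke t i) c →
                 ¬ Coloured G p (spoke s i) → ¬ UsedOn s p c → Move ((spoke t i , c) ∷ p)
  threat-reply {p} {i} {c} pp (gp , np) (uti , free-t) usi unused
    with others-coloured? p (spoke s i)
  ... | inj₁ others = ⊥-elim (np i (usi , uti , others))
  ... | inj₂ (f , f∈s , f≢i , uf) = f , c , (uf′ , free) , guarded′ , not-lonely
    where
    p′ = (spoke t i , c) ∷ p

    f≢t : f ≢ spoke t i
    f≢t refl = s≢t (trans (sym f∈s) (side-spoke t i))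

    uf′ : ¬ Coloured G p′ f
    uf′ cf = uf (coloured-back cf f≢t)

    free : ∀ g → Adjacent G f g → (g , c) ∉ p′
    free g adj (here refl) with adjacent⇒ adj
    ... | inj₁ same    = s≢t (trans (sym f∈s) (trans same (side-spoke t i)))
    ... | inj₂ partner = f≢i (partner-injective partner (spoke-partner s i))
    free g adj (there m) with adjacent⇒ adj
    ... | inj₁ same    = unused (g , trans (sym same) f∈s , m)
    ... | inj₂ partner = free-t g (same-side⇒adjacent (λ { refl → uti (c , m) })
      (trans (side-spoke t i) (sym (trans (partner-side partner) (cong opposite f∈s))))) m

    guarded′ : Guarded ((f , c) ∷ p′)
    guarded′ i′ _ _ (here eq) =
      ⊥-elim (s≢t (trans (sym f∈s) (trans (cong (side ∘ proj₁) (sym eq)) (side-spoke t i′))))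
    guarded′ _  _ _ (there (here eq)) = f , f∈s , here (cong (f ,_) (cong proj₂ eq))
    guarded′ i′ c′ u (there (there m)) =
      usedOn-there (usedOn-there (gp i′ c′ (u ∘ coloured-there ∘ coloured-there) m))

    not-lonely : ∀ i′ → ¬ Lonely ((f , c) ∷ p′) i′
    not-lonely i′ (_ , uti′ , others) =
      usi (coloured-back (coloured-back (others (spoke s i) (side-spoke s i) i≢i′) (f≢i ∘ sym))
                         (spoke-s≢spoke-t i i))
      where
      i≢i′ : spoke s i ≢ spoke s i′
      i≢i′ eq = uti′ (c , there (here (cong (λ j → spoke t j , c) (sym (spoke-injective s eq)))))

  reply : ∀ {p e c} → Proper p → Safe p → Legal G p e c →
          Complete G ((e , c) ∷ p) ⊎ Move ((e , c) ∷ p)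
  reply {p} {e} {c} pp (gp , np) legal
    with Fin.any? (λ i → (e ≟E spoke t i) ×-dec ¬? (coloured? p (spoke s i)) ×-dec ¬? (usedOn? s p c))
  ... | yes (i , refl , usi , unused) = inj₂ (threat-reply pp (gp , np) legal usi unused)
  ... | no  no-threat = guarded-move (proper-∷ pp legal) (guarded-∷ gp λ i e≡i usi →
    decidable-stable (usedOn? s p c) (λ unused → no-threat (i , e≡i , usi , unused)))

  safe-[] : Safe []
  safe-[] = (λ _ _ _ ()) , λ i (_ , _ , others) →
    case others (pendant s j) (side-pendant s j) (pendant≢spoke s j i) of λ ()
    where
    j : Fin (leaves s)
    j = Fin.fromℕ< (≤-trans (s≤s z≤n) (+-cancelˡ-< m _ _ t<s))

  lopsided-wins : AliceWins G k
  lopsided-wins = strategy-wins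
    (record { colourable = λ pp (gp , _) → colourable pp gp ; reply = reply }) safe-[]

candy-wins : ∀ m n₁ n₂ r k → m + n₁ ≤ k → m + n₂ ≤ k → 2 ≤ k →
             AliceWins (CandyWithIsolated m n₁ n₂ r) k
candy-wins m n₁ n₂ r k L≤k R≤k 2≤k with <-cmp n₁ n₂
... | tri< n₁<n₂ _ _ = Lopsided.lopsided-wins m n₁ n₂ r k R R≤k (+-monoʳ-< m n₁<n₂)
... | tri> _ _ n₂<n₁ = Lopsided.lopsided-wins m n₁ n₂ r k L L≤k (+-monoʳ-< m n₂<n₁)
... | tri≈ _ refl _ with 2 ≤? m + n₁
...   | yes 2≤size =
  let π , π-fpf = derangement (m + n₁) 2≤size in Mirror.mirror-wins m n₁ r k L≤k π π-fpf
...   | no  size<2 = Play.enough-colours⇒AliceWins k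
  (subst (_≤ k) (sym length-edges) (≤-trans (+-mono-≤ size≤1 size≤1) 2≤k))
  where
  open Candy m n₁ n₁ r
  size≤1 : m + n₁ ≤ 1
  size≤1 = ≤-pred (≰⇒> size<2)

lemma55 : (m n₁ n₂ r : ℕ) → 1 ≤ m → LineBNice (CandyWithIsolated m n₁ n₂ r)
lemma55 m n₁ n₂ r 1≤m _ ((es , clique , refl) , maximal) =
  candy-wins m n₁ n₂ r (length es) (side-clique L) (side-clique R) (maximal _ (partner-clique (v₁v₂ i))) ,
  λ k k<ω → Play.clique⇒¬AliceWins k clique k<ω
  where
  open Candy m n₁ n₂ r
  side-clique : ∀ s → size s ≤ length es
  side-clique s = subst (_≤ length es) (length-edgesAt s) (maximal _ (edgesAt-clique s))
  i : Fin m
  i = Fin.fromℕ< 1≤m
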